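{- Let $\mathcal B=\{B_1,B_2,B_3,B_4\}$ be a collection of four finite sets such that: for each $i\in\{1,2,3,4\}$, the number $o_i$ of elements lying in every $B_j$ with $j\ne i$ but not in $B_i$ is odd; exactly one element lies in all four sets; and every element of $B_1\cup B_2\cup B_3\cup B_4$ lies in at least three of the sets. Then $\mathcal B$ is not $\frac12$-splittable.
   Context: A collection $\{B_1,\dots,B_n\}$ of finite sets is $\frac12$-splittable if there is a set $S$ with $|S\cap B_i|\in\{\lfloor |B_i|/2\rfloor,\lceil |B_i|/2\rceil\}$ for all $i$. -}

module Defs where

open import Data.Nat using (ℕ; suc; _+_; _*_; _≤_; ⌊_/2⌋; ⌈_/2⌉)
open import Data.Fin using (Fin; zero; suc; _≟_)
open import Data.Fin.Subset using (Subset; _∈_; _∩_; _∪_; ∁; ∣_∣; ⊤; ⊥)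
open import Data.Bool using (Bool; true; false; if_then_else_)
open import Data.Vec using (tabulate; lookup)
open import Data.Product using (∃; Σ)
open import Data.Sum using (_⊎_)
open import Relation.Binary.PropositionalEquality using (_≡_)
open import Relation.Nullary using (does)

-- Finite sets are modelled as subsets of a finite ambient universe Fin n.
-- A collection of m sets is an indexed family  B : Fin m → Subset n.

Odd : ℕ → Set
Odd m = ∃ λ k → m ≡ 2 * k + 1

⋂ : ∀ {m n} → (Fin m → Subset n) → Subset n
⋂ {ℕ.zero}  B = ⊤
⋂ {suc m}   B = B zero ∩ ⋂ (λ i → B (suc i))

⋃ : ∀ {m n} → (Fin m → Subset n) → Subset n
⋃ {ℕ.zero}  B = ⊥
⋃ {suc m}   B = B zero ∪ ⋃ (λ i → B (suc i))

onlyOutside : ∀ {m n} → (Fin m → Subset n) → Fin m → Subset n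
onlyOutside B i = ∁ (B i) ∩ ⋂ (λ j → if does (j ≟ i) then ⊤ else B j)

indicesContaining : ∀ {m n} → (Fin m → Subset n) → Fin n → Subset m
indicesContaining B x = tabulate (λ i → lookup (B i) x)

multiplicity : ∀ {m n} → (Fin m → Subset n) → Fin n → ℕ
multiplicity B x = ∣ indicesContaining B x ∣

HalfSplittable : ∀ {m n} → (Fin m → Subset n) → Set
HalfSplittable {m} {n} B =
  Σ (Subset n) λ S → ∀ (i : Fin m) →
    (∣ S ∩ B i ∣ ≡ ⌊ ∣ B i ∣ /2⌋) ⊎ (∣ S ∩ B i ∣ ≡ ⌈ ∣ B i ∣ /2⌉)

-- Every element lies in no set, in exactly three, or in all four, so each B i splits into the
-- core ⋂ B and the three sets Oⱼ (j ≠ i) of elements missing only from Bⱼ. Hence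
-- |B i| = Σ_{j≠i} |Oⱼ| + 1 is even (three odd terms plus one), and a half-splitting set S
-- satisfies 2|S ∩ B i| = |B i|. Summing over i, each element of S ∩ Oⱼ is counted three times
-- and the element of S ∩ ⋂ B (if any) four times, so with X = Σ|S ∩ Oⱼ|, t = |S ∩ ⋂ B| ≤ 1 and
-- O = Σ|Oⱼ| we get 2(3X + 4t) = 3O + 4, which is impossible modulo 3.
module Submission where

open import Defs
open import Data.Nat using (ℕ; zero; suc; _+_; _*_; _≤_; _≤?_; ⌊_/2⌋; ⌈_/2⌉; s≤s)
open import Data.Nat.Properties using (+-cancelʳ-≡; *-comm; ≤-trans; ≤-reflexive; n≡⌊n+n/2⌋; n≡⌈n+n/2⌉)
open import Data.Nat.Divisibility using (_∣_; divides; ∣m+n∣m⇒∣n; m∣m*n; ∣1⇒≡1)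
open import Data.Nat.Tactic.RingSolver using (solve-∀)
open import Data.Fin using (Fin; zero; suc)
open import Data.Fin.Patterns using (0F; 1F; 2F; 3F)
open import Data.Fin.Subset using (Subset; _∈_; _∩_; ∣_∣; ⊤; inside; outside)
open import Data.Fin.Subset.Properties using (∩-identityˡ; p⊆q⇒∣p∣≤∣q∣; p∩q⊆q; x∈p∪q⁺)
open import Data.Vec using ([]; _∷_; here; there; lookup)
open import Data.Vec.Properties using ([]=⇒lookup; lookup⇒[]=; lookup∘tabulate)
open import Data.Product using (_,_)
open import Data.Sum using (_⊎_; inj₁; inj₂)
open import Relation.Binary.PropositionalEquality using (_≡_; _≢_; refl; sym; trans; cong; cong₂; subst; module ≡-Reasoning)
open import Relation.Nullary using (¬_; contradiction)
open import Relation.Nullary.Decidable using (from-no)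

open ≡-Reasoning

∀-Fin4 : ∀ {p} {P : Fin 4 → Set p} →
  P 0F → P 1F → P 2F → P 3F → ∀ i → P i
∀-Fin4 p₀ p₁ p₂ p₃ 0F = p₀
∀-Fin4 p₀ p₁ p₂ p₃ 1F = p₁
∀-Fin4 p₀ p₁ p₂ p₃ 2F = p₂
∀-Fin4 p₀ p₁ p₂ p₃ 3F = p₃

Σ₄ : (Fin 4 → ℕ) → ℕ
Σ₄ f = f 0F + f 1F + f 2F + f 3F

Σ₄-cong : ∀ {f g : Fin 4 → ℕ} → (∀ i → f i ≡ g i) → Σ₄ f ≡ Σ₄ g
Σ₄-cong f≗g = cong₂ _+_ (cong₂ _+_ (cong₂ _+_ (f≗g 0F) (f≗g 1F)) (f≗g 2F)) (f≗g 3F)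

Σ₄-+ : ∀ (f g : Fin 4 → ℕ) → Σ₄ f + Σ₄ g ≡ Σ₄ (λ i → f i + g i)
Σ₄-+ f g = interchange (f 0F) (f 1F) (f 2F) (f 3F) (g 0F) (g 1F) (g 2F) (g 3F)
  where
  interchange : ∀ a b c d w x y z →
    a + b + c + d + (w + x + y + z) ≡ (a + w) + (b + x) + (c + y) + (d + z)
  interchange = solve-∀

Σ₄-*ˡ : ∀ k (f : Fin 4 → ℕ) → k * Σ₄ f ≡ Σ₄ (λ i → k * f i)
Σ₄-*ˡ k f = distrib k (f 0F) (f 1F) (f 2F) (f 3F)
  where
  distrib : ∀ k a b c d → k * (a + b + c + d) ≡ k * a + k * b + k * c + k * d
  distrib = solve-∀

Σ₄-decomposition : ∀ (f g : Fin 4 → ℕ) {e} → (∀ i → f i + g i ≡ Σ₄ g + e) → Σ₄ f ≡ 3 * Σ₄ g + 4 * e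
Σ₄-decomposition f g {e} split = +-cancelʳ-≡ (Σ₄ g) _ _ (begin
  Σ₄ f + Σ₄ g                ≡⟨ Σ₄-+ f g ⟩
  Σ₄ (λ i → f i + g i)       ≡⟨ Σ₄-cong split ⟩
  Σ₄ (λ _ → Σ₄ g + e)        ≡⟨ four-copies (Σ₄ g) e ⟩
  3 * Σ₄ g + 4 * e + Σ₄ g    ∎)
  where
  four-copies : ∀ G e → G + e + (G + e) + (G + e) + (G + e) ≡ 3 * G + 4 * e + G
  four-copies = solve-∀

Σ₄-odd : ∀ {o : Fin 4 → ℕ} → (∀ j → Odd (o j)) → 2 ∣ Σ₄ o
Σ₄-odd {o} odd with odd 0F | odd 1F | odd 2F | odd 3F
... | k₀ , o₀ | k₁ , o₁ | k₂ , o₂ | k₃ , o₃ =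
  divides (k₀ + k₁ + k₂ + k₃ + 2) (trans (cong₂ _+_ (cong₂ _+_ (cong₂ _+_ o₀ o₁) o₂) o₃) (four-odds k₀ k₁ k₂ k₃))
  where
  four-odds : ∀ a b c d → 2 * a + 1 + (2 * b + 1) + (2 * c + 1) + (2 * d + 1) ≡ (a + b + c + d + 2) * 2
  four-odds = solve-∀

even-complement : ∀ {o : Fin 4 → ℕ} → (∀ j → Odd (o j)) → ∀ {m} i → m + o i ≡ Σ₄ o + 1 → 2 ∣ m
even-complement {o} odd {m} i eq with odd i
... | k , oᵢ≡2k+1 = ∣m+n∣m⇒∣n (subst (2 ∣_) shifted (Σ₄-odd odd)) (m∣m*n k)
  where
  shifted : Σ₄ o ≡ 2 * k + m
  shifted = +-cancelʳ-≡ 1 _ _ (begin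
    Σ₄ o + 1            ≡⟨ eq ⟨
    m + o i             ≡⟨ cong (m +_) oᵢ≡2k+1 ⟩
    m + (2 * k + 1)     ≡⟨ rearrange m k ⟩
    2 * k + m + 1       ∎)
    where
    rearrange : ∀ m k → m + (2 * k + 1) ≡ 2 * k + m + 1
    rearrange = solve-∀

even⇒half-exact : ∀ {m q} → 2 ∣ m → (q ≡ ⌊ m /2⌋) ⊎ (q ≡ ⌈ m /2⌉) → 2 * q ≡ m
even⇒half-exact {q = q} (divides h refl) q≡half = begin
  2 * q  ≡⟨ cong (2 *_) (q≡h q≡half) ⟩
  2 * h  ≡⟨ *-comm 2 h ⟩
  h * 2  ∎
  where
  h*2≡h+h : ∀ h → h * 2 ≡ h + h
  h*2≡h+h = solve-∀
  q≡h : (q ≡ ⌊ h * 2 /2⌋) ⊎ (q ≡ ⌈ h * 2 /2⌉) → q ≡ h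
  q≡h (inj₁ q≡⌊⌋) = trans q≡⌊⌋ (trans (cong ⌊_/2⌋ (h*2≡h+h h)) (sym (n≡⌊n+n/2⌋ h)))
  q≡h (inj₂ q≡⌈⌉) = trans q≡⌈⌉ (trans (cong ⌈_/2⌉ (h*2≡h+h h)) (sym (n≡⌈n+n/2⌉ h)))

3*a≢3*b+1 : ∀ a b → 3 * a ≢ 3 * b + 1
3*a≢3*b+1 a b eq = contradiction (∣1⇒≡1 (∣m+n∣m⇒∣n (subst (3 ∣_) eq (m∣m*n a)) (m∣m*n b))) λ ()

mod3-obstruction : ∀ X O t → t ≤ 1 → 2 * (3 * X + 4 * t) ≢ 3 * O + 4
mod3-obstruction X O zero _ eq = 3*a≢3*b+1 (2 * X) (O + 1) (begin
  3 * (2 * X)              ≡⟨ lhs X ⟩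
  2 * (3 * X + 4 * 0)      ≡⟨ eq ⟩
  3 * O + 4                ≡⟨ rhs O ⟩
  3 * (O + 1) + 1          ∎)
  where
  lhs : ∀ X → 3 * (2 * X) ≡ 2 * (3 * X + 4 * 0)
  lhs = solve-∀
  rhs : ∀ O → 3 * O + 4 ≡ 3 * (O + 1) + 1
  rhs = solve-∀
mod3-obstruction X O (suc zero) _ eq = 3*a≢3*b+1 O (2 * X + 1) (+-cancelʳ-≡ 4 _ _ (begin
  3 * O + 4                ≡⟨ eq ⟨
  2 * (3 * X + 4 * 1)      ≡⟨ lhs X ⟩
  3 * (2 * X + 1) + 1 + 4  ∎))
  where
  lhs : ∀ X → 2 * (3 * X + 4 * 1) ≡ 3 * (2 * X + 1) + 1 + 4
  lhs = solve-∀
mod3-obstruction X O (suc (suc t)) (s≤s ())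

data Profile : Subset 4 → Set where
  nowhere    : Profile (outside ∷ outside ∷ outside ∷ outside ∷ [])
  missing₀   : Profile (outside ∷ inside  ∷ inside  ∷ inside  ∷ [])
  missing₁   : Profile (inside  ∷ outside ∷ inside  ∷ inside  ∷ [])
  missing₂   : Profile (inside  ∷ inside  ∷ outside ∷ inside  ∷ [])
  missing₃   : Profile (inside  ∷ inside  ∷ inside  ∷ outside ∷ [])
  everywhere : Profile (inside  ∷ inside  ∷ inside  ∷ inside  ∷ [])

empty-or-≥3⇒Profile : ∀ (v : Subset 4) → (∀ {i} → i ∈ v → 3 ≤ ∣ v ∣) → Profile v
empty-or-≥3⇒Profile (outside ∷ outside ∷ outside ∷ outside ∷ []) _ = nowhere
empty-or-≥3⇒Profile (outside ∷ inside  ∷ inside  ∷ inside  ∷ []) _ = missing₀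
empty-or-≥3⇒Profile (inside  ∷ outside ∷ inside  ∷ inside  ∷ []) _ = missing₁
empty-or-≥3⇒Profile (inside  ∷ inside  ∷ outside ∷ inside  ∷ []) _ = missing₂
empty-or-≥3⇒Profile (inside  ∷ inside  ∷ inside  ∷ outside ∷ []) _ = missing₃
empty-or-≥3⇒Profile (inside  ∷ inside  ∷ inside  ∷ inside  ∷ []) _ = everywhere
empty-or-≥3⇒Profile (inside  ∷ outside ∷ outside ∷ outside ∷ []) h = contradiction (h here) (from-no (3 ≤? 1))
empty-or-≥3⇒Profile (outside ∷ inside  ∷ outside ∷ outside ∷ []) h = contradiction (h (there here)) (from-no (3 ≤? 1))
empty-or-≥3⇒Profile (outside ∷ outside ∷ inside  ∷ outside ∷ []) h = contradiction (h (there (there here))) (from-no (3 ≤? 1))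
empty-or-≥3⇒Profile (outside ∷ outside ∷ outside ∷ inside  ∷ []) h = contradiction (h (there (there (there here)))) (from-no (3 ≤? 1))
empty-or-≥3⇒Profile (inside  ∷ inside  ∷ outside ∷ outside ∷ []) h = contradiction (h here) (from-no (3 ≤? 2))
empty-or-≥3⇒Profile (inside  ∷ outside ∷ inside  ∷ outside ∷ []) h = contradiction (h here) (from-no (3 ≤? 2))
empty-or-≥3⇒Profile (inside  ∷ outside ∷ outside ∷ inside  ∷ []) h = contradiction (h here) (from-no (3 ≤? 2))
empty-or-≥3⇒Profile (outside ∷ inside  ∷ inside  ∷ outside ∷ []) h = contradiction (h (there here)) (from-no (3 ≤? 2))
empty-or-≥3⇒Profile (outside ∷ inside  ∷ outside ∷ inside  ∷ []) h = contradiction (h (there here)) (from-no (3 ≤? 2))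
empty-or-≥3⇒Profile (outside ∷ outside ∷ inside  ∷ inside  ∷ []) h = contradiction (h (there (there here))) (from-no (3 ≤? 2))

x∈Bi⇒x∈⋃B : ∀ {m n} (B : Fin m → Subset n) i {x} → x ∈ B i → x ∈ ⋃ B
x∈Bi⇒x∈⋃B B zero    x∈Bi = x∈p∪q⁺ (inj₁ x∈Bi)
x∈Bi⇒x∈⋃B B (suc i) x∈Bi = x∈p∪q⁺ (inj₂ (x∈Bi⇒x∈⋃B (λ j → B (suc j)) i x∈Bi))

i∈indicesContaining⇒x∈Bi : ∀ {m n} (B : Fin m → Subset n) x {i} → i ∈ indicesContaining B x → x ∈ B i
i∈indicesContaining⇒x∈Bi B x {i} i∈ =
  lookup⇒[]= x (B i) (trans (sym (lookup∘tabulate (λ j → lookup (B j) x) i)) ([]=⇒lookup i∈))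

covered⇒Profile : ∀ {n} (B : Fin 4 → Subset n) → (∀ x → x ∈ ⋃ B → 3 ≤ multiplicity B x) →
  ∀ x → Profile (indicesContaining B x)
covered⇒Profile B cover x = empty-or-≥3⇒Profile (indicesContaining B x)
  (λ {i} i∈ → cover x (x∈Bi⇒x∈⋃B B i (i∈indicesContaining⇒x∈Bi B x i∈)))

-- A record rather than a bare equation, so that unification can recover the seven sets from it.
record CardinalitySplit {n} (P Q C₀ C₁ C₂ C₃ E : Subset n) : Set where
  constructor splits
  field
    cardinalities : ∣ P ∣ + ∣ Q ∣ ≡ ∣ C₀ ∣ + ∣ C₁ ∣ + ∣ C₂ ∣ + ∣ C₃ ∣ + ∣ E ∣

open CardinalitySplit using (cardinalities)

Decomposes : ∀ {n} → Subset n → (Fin 4 → Subset n) → Fin 4 → Set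
Decomposes s B i = CardinalitySplit (s ∩ B i) (s ∩ onlyOutside B i)
  (s ∩ onlyOutside B 0F) (s ∩ onlyOutside B 1F)
  (s ∩ onlyOutside B 2F) (s ∩ onlyOutside B 3F)
  (s ∩ ⋂ B)

pointwise-decomposition : ∀ y {v} → Profile v → ∀ i → Decomposes (y ∷ []) (λ j → lookup v j ∷ []) i
pointwise-decomposition outside _          = ∀-Fin4 (splits refl) (splits refl) (splits refl) (splits refl)
pointwise-decomposition inside  nowhere    = ∀-Fin4 (splits refl) (splits refl) (splits refl) (splits refl)
pointwise-decomposition inside  missing₀   = ∀-Fin4 (splits refl) (splits refl) (splits refl) (splits refl)
pointwise-decomposition inside  missing₁   = ∀-Fin4 (splits refl) (splits refl) (splits refl) (splits refl)
pointwise-decomposition inside  missing₂   = ∀-Fin4 (splits refl) (splits refl) (splits refl) (splits refl)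
pointwise-decomposition inside  missing₃   = ∀-Fin4 (splits refl) (splits refl) (splits refl) (splits refl)
pointwise-decomposition inside  everywhere = ∀-Fin4 (splits refl) (splits refl) (splits refl) (splits refl)

∣x∷p∣≡∣x∷[]∣+∣p∣ : ∀ {n} x (p : Subset n) → ∣ x ∷ p ∣ ≡ ∣ x ∷ [] ∣ + ∣ p ∣
∣x∷p∣≡∣x∷[]∣+∣p∣ inside  p = refl
∣x∷p∣≡∣x∷[]∣+∣p∣ outside p = refl

add-equations : ∀ a b c₀ c₁ c₂ c₃ e A B C₀ C₁ C₂ C₃ E →
  a + b ≡ c₀ + c₁ + c₂ + c₃ + e → A + B ≡ C₀ + C₁ + C₂ + C₃ + E →
  (a + A) + (b + B) ≡ (c₀ + C₀) + (c₁ + C₁) + (c₂ + C₂) + (c₃ + C₃) + (e + E)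
add-equations a b c₀ c₁ c₂ c₃ e A B C₀ C₁ C₂ C₃ E heads tails = begin
  (a + A) + (b + B)                                  ≡⟨ regroup₂ a A b B ⟩
  (a + b) + (A + B)                                  ≡⟨ cong₂ _+_ heads tails ⟩
  (c₀ + c₁ + c₂ + c₃ + e) + (C₀ + C₁ + C₂ + C₃ + E)  ≡⟨ regroup₅ c₀ c₁ c₂ c₃ e C₀ C₁ C₂ C₃ E ⟩
  (c₀ + C₀) + (c₁ + C₁) + (c₂ + C₂) + (c₃ + C₃) + (e + E) ∎
  where
  regroup₂ : ∀ a A b B → (a + A) + (b + B) ≡ (a + b) + (A + B)
  regroup₂ = solve-∀
  regroup₅ : ∀ c₀ c₁ c₂ c₃ e C₀ C₁ C₂ C₃ E →
    (c₀ + c₁ + c₂ + c₃ + e) + (C₀ + C₁ + C₂ + C₃ + E) ≡ (c₀ + C₀) + (c₁ + C₁) + (c₂ + C₂) + (c₃ + C₃) + (e + E)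
  regroup₅ = solve-∀

∷-decomposition : ∀ {n} {a b c₀ c₁ c₂ c₃ e} {A B C₀ C₁ C₂ C₃ E : Subset n} →
  CardinalitySplit (a ∷ []) (b ∷ []) (c₀ ∷ []) (c₁ ∷ []) (c₂ ∷ []) (c₃ ∷ []) (e ∷ []) →
  CardinalitySplit A B C₀ C₁ C₂ C₃ E →
  CardinalitySplit (a ∷ A) (b ∷ B) (c₀ ∷ C₀) (c₁ ∷ C₁) (c₂ ∷ C₂) (c₃ ∷ C₃) (e ∷ E)
∷-decomposition {_} {a} {b} {c₀} {c₁} {c₂} {c₃} {e} {A} {B} {C₀} {C₁} {C₂} {C₃} {E} (splits heads) (splits tails) =
  splits (trans (cong₂ _+_ (cons a A) (cons b B))
         (trans (add-equations (∣ a ∷ [] ∣) (∣ b ∷ [] ∣) (∣ c₀ ∷ [] ∣) (∣ c₁ ∷ [] ∣) (∣ c₂ ∷ [] ∣) (∣ c₃ ∷ [] ∣)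
                               (∣ e ∷ [] ∣) (∣ A ∣) (∣ B ∣) (∣ C₀ ∣) (∣ C₁ ∣) (∣ C₂ ∣) (∣ C₃ ∣) (∣ E ∣) heads tails)
                (sym (cong₂ _+_ (cong₂ _+_ (cong₂ _+_ (cong₂ _+_ (cons c₀ C₀) (cons c₁ C₁)) (cons c₂ C₂)) (cons c₃ C₃))
                                (cons e E)))))
  where
  cons = ∣x∷p∣≡∣x∷[]∣+∣p∣

-- Induction on the universe needs the four sets in constructor form, hence the explicit vector.
decomposition′ : ∀ {n} (s a b c d : Subset n) →
  (∀ x → Profile (indicesContaining (lookup (a ∷ b ∷ c ∷ d ∷ [])) x)) →
  ∀ i → Decomposes s (lookup (a ∷ b ∷ c ∷ d ∷ [])) i
decomposition′ [] [] [] [] [] _ = ∀-Fin4 (splits refl) (splits refl) (splits refl) (splits refl)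
decomposition′ (y ∷ s) (xa ∷ a) (xb ∷ b) (xc ∷ c) (xd ∷ d) profile =
  ∀-Fin4 (∷-decomposition (heads 0F) (tails 0F))
         (∷-decomposition (heads 1F) (tails 1F))
         (∷-decomposition (heads 2F) (tails 2F))
         (∷-decomposition (heads 3F) (tails 3F))
  where
  heads = pointwise-decomposition y (profile zero)
  tails = decomposition′ s a b c d (λ x → profile (suc x))

decomposition : ∀ {n} (s : Subset n) (B : Fin 4 → Subset n) →
  (∀ x → Profile (indicesContaining B x)) → ∀ i → Decomposes s B i
decomposition s B profile = ∀-Fin4 (d 0F) (d 1F) (d 2F) (d 3F)
  where
  d = decomposition′ s (B 0F) (B 1F) (B 2F) (B 3F) profile

∣⊤∩p∣≡∣p∣ : ∀ {n} (p : Subset n) → ∣ ⊤ ∩ p ∣ ≡ ∣ p ∣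
∣⊤∩p∣≡∣p∣ p = cong ∣_∣ (∩-identityˡ p)

cardinality-decomposition : ∀ {n} (B : Fin 4 → Subset n) → (∀ x → Profile (indicesContaining B x)) →
  ∀ i → ∣ B i ∣ + ∣ onlyOutside B i ∣ ≡ Σ₄ (λ j → ∣ onlyOutside B j ∣) + ∣ ⋂ B ∣
cardinality-decomposition B profile i = begin
  ∣ B i ∣ + ∣ onlyOutside B i ∣
    ≡⟨ cong₂ _+_ (∣⊤∩p∣≡∣p∣ (B i)) (∣⊤∩p∣≡∣p∣ (onlyOutside B i)) ⟨
  ∣ ⊤ ∩ B i ∣ + ∣ ⊤ ∩ onlyOutside B i ∣
    ≡⟨ cardinalities (decomposition ⊤ B profile i) ⟩
  Σ₄ (λ j → ∣ ⊤ ∩ onlyOutside B j ∣) + ∣ ⊤ ∩ ⋂ B ∣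
    ≡⟨ cong₂ _+_ (Σ₄-cong λ j → ∣⊤∩p∣≡∣p∣ (onlyOutside B j)) (∣⊤∩p∣≡∣p∣ (⋂ B)) ⟩
  Σ₄ (λ j → ∣ onlyOutside B j ∣) + ∣ ⋂ B ∣ ∎

propositionA1 : ∀ {n : ℕ} (B : Fin 4 → Subset n) →
    (∀ (i : Fin 4) → Odd ∣ onlyOutside B i ∣) →
    ∣ ⋂ B ∣ ≡ 1 →
    (∀ (x : Fin n) → x ∈ ⋃ B → 3 ≤ multiplicity B x) →
    ¬ HalfSplittable B
propositionA1 B odd core cover (S , split) = mod3-obstruction X O t t≤1 (begin
  2 * (3 * X + 4 * t)
    ≡⟨ cong (2 *_) (Σ₄-decomposition (λ i → ∣ S ∩ B i ∣) (λ j → ∣ S ∩ onlyOutside B j ∣) meets) ⟨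
  2 * Σ₄ (λ i → ∣ S ∩ B i ∣)
    ≡⟨ Σ₄-*ˡ 2 (λ i → ∣ S ∩ B i ∣) ⟩
  Σ₄ (λ i → 2 * ∣ S ∩ B i ∣)
    ≡⟨ Σ₄-cong halves ⟩
  Σ₄ (λ i → ∣ B i ∣)
    ≡⟨ Σ₄-decomposition (λ i → ∣ B i ∣) (λ j → ∣ onlyOutside B j ∣) sizes ⟩
  3 * O + 4 * 1 ∎)
  where
  profile = covered⇒Profile B cover
  O = Σ₄ λ j → ∣ onlyOutside B j ∣
  X = Σ₄ λ j → ∣ S ∩ onlyOutside B j ∣
  t = ∣ S ∩ ⋂ B ∣
  t≤1 : t ≤ 1
  t≤1 = ≤-trans (p⊆q⇒∣p∣≤∣q∣ (p∩q⊆q S (⋂ B))) (≤-reflexive core)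
  meets : ∀ i → ∣ S ∩ B i ∣ + ∣ S ∩ onlyOutside B i ∣ ≡ X + t
  meets i = cardinalities (decomposition S B profile i)
  sizes : ∀ i → ∣ B i ∣ + ∣ onlyOutside B i ∣ ≡ O + 1
  sizes i = trans (cardinality-decomposition B profile i) (cong (O +_) core)
  halves : ∀ i → 2 * ∣ S ∩ B i ∣ ≡ ∣ B i ∣
  halves i = even⇒half-exact (even-complement odd i (sizes i)) (split i)
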